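{- Let $m\ge n\ge1$ be integers. Then \[\mathcal{I}_m(n)=(n+2)3^{n-2}+(m-n)\sum_{i=0}^{n-1}\mathcal{D}(i,1)\mathcal{D}(n-i,1)+2\sum_{k=0}^{n-3}(n-k-2)3^{n-k-3}\mathcal{M}_k,\] where $\mathcal{D}$ is computed in a table with at least $n$ rows and $\mathcal{D}(0,1):=1$.
   Context: $\mathcal{I}_m(n)$ is the number of sequences $(r_1,\dots,r_n)$ with $r_i\in\{1,\dots,m\}$, $|r_{i+1}-r_i|\le1$ (lattice paths with steps $(1,0),(1,1),(1,-1)$ from the first to the last column of the table with $m$ rows and $n$ columns, staying inside). For $s\ge1$, $\mathcal{D}(s,t)$ is the number of sequences $(r_1,\dots,r_s)$ with values in $\{1,\dots,m\}$, $|r_{i+1}-r_i|\le1$, $r_s=t$ (for $s\le n\le m$ this does not depend on $m$); $\mathcal{D}(0,1)=1$. $\mathcal{M}_k$ is the $k$-th Motzkin number (number of lattice paths from $(0,0)$ to $(k,0)$ with steps $(1,1),(1,-1),(1,0)$ never going below the $x$-axis). Empty sums are $0$. -}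

module Defs where

open import Data.Nat as ℕ using (ℕ; zero; suc; _∸_; _≤_; _≤?_)
open import Data.Fin using (Fin; toℕ; zero; suc)
open import Data.Fin.Properties as FinP using ()
open import Data.Vec using (Vec; []; _∷_; last)
open import Data.List using (List; []; _∷_; length; filter; concatMap; map; foldr; upTo; allFin)
open import Data.List as L using ()
open import Data.Bool using (Bool; true; false; _∧_; T)

open import Data.Integer using (ℤ; +_; -[1+_])
open import Data.Rational using (ℚ; _/_)
open import Data.Rational as Q using ()
open import Relation.Nullary.Decidable using (⌊_⌋)
open import Data.Nat.ListAction using (sum)

-- all vectors of length n with entries in Fin m (i.e. values 1..m, value j+1 encoded as j)
allVecs : (m n : ℕ) → List (Vec (Fin m) n)
allVecs m zero = [] ∷ []
allVecs m (suc n) = concatMap (λ x → map (x ∷_) (allVecs m n)) (allFin m)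

adj : {m : ℕ} → Fin m → Fin m → Bool
adj a b = ⌊ toℕ a ≤? suc (toℕ b) ⌋ ∧ ⌊ toℕ b ≤? suc (toℕ a) ⌋

admissible : {m n : ℕ} → Vec (Fin m) n → Bool
admissible [] = true
admissible (x ∷ []) = true
admissible (x ∷ y ∷ xs) = adj x y ∧ admissible (y ∷ xs)

I : (m n : ℕ) → ℕ
I m n = length (filter (λ v → T? (admissible v)) (allVecs m n))
  where
  open import Data.Bool using (T?)

-- ends with the value t (t : Fin m encodes the value toℕ t + 1)
endsAt : {m s : ℕ} → Fin m → Vec (Fin m) s → Bool
endsAt t [] = false
endsAt t (x ∷ xs) = go x xs
  where
  go : {k : ℕ} → Fin _ → Vec (Fin _) k → Bool
  go y [] = ⌊ toℕ y ℕ.≟ toℕ t ⌋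
  go y (z ∷ zs) = go z zs

-- D(s, t) computed in a table with m rows, for s ≥ 1; D(0, ·) := 1 by convention
-- (the paper only uses D(0,1) = 1).
D : (m s : ℕ) → Fin m → ℕ
D m zero t = 1
D m (suc s) t = length (filter (λ v → T? (admissible v ∧ endsAt t v)) (allVecs m (suc s)))
  where
  open import Data.Bool using (T?)

data Step : Set where
  U Dn F : Step

allSteps : ℕ → List (List Step)
allSteps zero = [] ∷ []
allSteps (suc k) = concatMap (λ s → map (s ∷_) (allSteps k)) (U ∷ Dn ∷ F ∷ [])

motzkinFrom : ℕ → List Step → Bool
motzkinFrom zero [] = true
motzkinFrom (suc h) [] = false
motzkinFrom h (U ∷ s) = motzkinFrom (suc h) s
motzkinFrom zero (Dn ∷ s) = false
motzkinFrom (suc h) (Dn ∷ s) = motzkinFrom h s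
motzkinFrom h (F ∷ s) = motzkinFrom h s

Motzkin : ℕ → ℕ
Motzkin k = length (filter (λ p → T? (motzkinFrom 0 p)) (allSteps k))
  where
  open import Data.Bool using (T?)

sumTo : ℕ → (ℕ → ℕ) → ℕ
sumTo n f = sum (map f (upTo n))

ℚpow : ℚ → ℕ → ℚ
ℚpow q zero = Q.1ℚ
ℚpow q (suc k) = q Q.* ℚpow q k

pow3 : ℤ → ℚ
pow3 (+ k) = (+ (3 ℕ.^ k)) / 1
pow3 -[1+ k ] = ℚpow ((+ 1) / 3) (suc k)

ℕ→ℚ : ℕ → ℚ
ℕ→ℚ k = (+ k) / 1

-- the value 1 (row 1) as an element of Fin m, available since 1 ≤ n ≤ m
fin0 : {m n : ℕ} → 1 ≤ n → n ≤ m → Fin m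
fin0 {suc m} _ _ = zero
fin0 {zero} (ℕ.s≤s _) ()

-- Rows are numbered 0, …, m − 1, admissible sequences are walks with steps −1, 0, +1, and
-- every count involved is an iterate of the transfer operator of such walks, on the strip
-- of m rows or on the half-line ℕ. A walk of k < m steps cannot leave the strip through
-- both boundaries, so inclusion–exclusion against the half-line and its mirror image gives
-- I_m(k+1) + 2·exits(k) = m·3^k, where exits(k) counts the walks leaving ℕ over all
-- starting heights; and for s ≤ m, D(s,1) is the number of (s−1)-step walks from 0 that
-- stay in ℕ (meanders). The remaining identities, Σ D(i,1) D(n−i,1) = 3^(n−1) and a closed
-- form of exits in terms of Motzkin numbers, follow by induction from the first-passage
-- decomposition of Motzkin paths and from walks(k+1) + walksTo0(k) = 3·walks(k).

module Submission where

open import Defs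
open import Data.Nat using (ℕ; _≤_; _+_; _*_; _∸_; _^_; zero; suc)
open import Data.Fin using (Fin; zero)
open import Data.Integer using (ℤ; +_; _-_)
open import Data.Rational using (ℚ) renaming (_+_ to _+ℚ_; _*_ to _*ℚ_)
open import Relation.Binary.PropositionalEquality using (_≡_)

open import Data.Bool using (Bool; true; false; _∧_; if_then_else_; T?)
open import Data.Bool.Properties using (∧-assoc; ∧-identityʳ)
open import Data.Fin using (toℕ; suc)
open import Data.Integer using () renaming (_+_ to _+ℤ_)
import Data.Integer.Properties as ℤ
open import Data.List using (List; []; _∷_; _++_; length; filterᵇ; map; concatMap; applyUpTo; tabulate; allFin)
open import Data.List.Properties using (length-++; filter-++; map-upTo; map-tabulate; tabulate-cong)
open import Data.Nat using (_<_; z≤n; s≤s; _≤ᵇ_; _<ᵇ_)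
open import Data.Nat.Coprimality as Coprime using (1-coprimeTo)
open import Data.Nat.ListAction using (sum)
open import Data.Nat.Properties
open import Data.Nat.Tactic.RingSolver using (solve-∀)
open import Data.Rational using (mkℚ; _/_)
open import Data.Rational.Properties using (normalize-coprime)
open import Data.Vec using (Vec; []; _∷_)
open import Relation.Binary.PropositionalEquality using (refl; sym; trans; cong; cong₂; subst; module ≡-Reasoning)
open import Relation.Nullary.Decidable using (isYes≗does)

open ≡-Reasoning

∑ : ℕ → (ℕ → ℕ) → ℕ
∑ zero    f = 0
∑ (suc n) f = f 0 + ∑ n (λ i → f (suc i))

∑-cong : ∀ n {f g : ℕ → ℕ} → (∀ i → i < n → f i ≡ g i) → ∑ n f ≡ ∑ n g
∑-cong zero    eq = refl
∑-cong (suc n) eq = cong₂ _+_ (eq 0 (s≤s z≤n)) (∑-cong n (λ i i<n → eq (suc i) (s≤s i<n)))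

∑-const : ∀ n c → ∑ n (λ _ → c) ≡ n * c
∑-const zero    c = refl
∑-const (suc n) c = cong (_+_ c) (∑-const n c)

∑-+ : ∀ n (f g : ℕ → ℕ) → ∑ n (λ i → f i + g i) ≡ ∑ n f + ∑ n g
∑-+ zero    f g = refl
∑-+ (suc n) f g = begin
  f 0 + g 0 + ∑ n (λ i → f (suc i) + g (suc i)) ≡⟨ cong (_+_ (f 0 + g 0)) (∑-+ n _ _) ⟩
  f 0 + g 0 + (∑ n _ + ∑ n _)                   ≡⟨ +-assoc-middle (f 0) (g 0) _ _ ⟩
  f 0 + ∑ n _ + (g 0 + ∑ n _)                   ∎
  where
  +-assoc-middle : ∀ a b c d → a + b + (c + d) ≡ a + c + (b + d)
  +-assoc-middle = solve-∀

∑-*ˡ : ∀ n c (f : ℕ → ℕ) → ∑ n (λ i → c * f i) ≡ c * ∑ n f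
∑-*ˡ zero    c f = sym (*-zeroʳ c)
∑-*ˡ (suc n) c f = trans (cong (_+_ (c * f 0)) (∑-*ˡ n c _)) (sym (*-distribˡ-+ c (f 0) _))

∑-suc : ∀ n (f : ℕ → ℕ) → ∑ (suc n) f ≡ ∑ n f + f n
∑-suc zero    f = +-comm (f 0) 0
∑-suc (suc n) f = trans (cong (_+_ (f 0)) (∑-suc n _)) (sym (+-assoc (f 0) _ _))

∑-reflect : ∀ n (f g : ℕ → ℕ) → (∀ x r → suc (x + r) ≡ n → f x ≡ g r) → ∑ n f ≡ ∑ n g
∑-reflect zero    f g eq = refl
∑-reflect (suc n) f g eq = begin
  f 0 + ∑ n (λ i → f (suc i)) ≡⟨ cong₂ _+_ (eq 0 n refl) (∑-reflect n _ g (λ x r e → eq (suc x) r (cong suc e))) ⟩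
  g n + ∑ n g                 ≡⟨ +-comm (g n) _ ⟩
  ∑ n g + g n                 ≡⟨ ∑-suc n g ⟨
  ∑ (suc n) g                 ∎

sum-applyUpTo : ∀ n (f : ℕ → ℕ) → sum (applyUpTo f n) ≡ ∑ n f
sum-applyUpTo zero    f = refl
sum-applyUpTo (suc n) f = cong (_+_ (f 0)) (sum-applyUpTo n (λ i → f (suc i)))

sumTo≡∑ : ∀ n f → sumTo n f ≡ ∑ n f
sumTo≡∑ n f = trans (cong sum (map-upTo f n)) (sum-applyUpTo n f)

sum-tabulate-toℕ : ∀ m (f : ℕ → ℕ) → sum (tabulate {n = m} (λ i → f (toℕ i))) ≡ ∑ m f
sum-tabulate-toℕ zero    f = refl
sum-tabulate-toℕ (suc m) f = cong (_+_ (f 0)) (sum-tabulate-toℕ m (λ i → f (suc i)))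

sum-allFin : ∀ m (g : Fin m → ℕ) (f : ℕ → ℕ) → (∀ y → g y ≡ f (toℕ y)) →
             sum (map g (allFin m)) ≡ ∑ m f
sum-allFin m g f eq = begin
  sum (map g (allFin m))             ≡⟨ cong sum (map-tabulate (λ i → i) g) ⟩
  sum (tabulate g)                   ≡⟨ cong sum (tabulate-cong eq) ⟩
  sum (tabulate {n = m} (λ i → f (toℕ i)))   ≡⟨ sum-tabulate-toℕ m f ⟩
  ∑ m f                              ∎

count : {A : Set} → (A → Bool) → List A → ℕ
count p xs = length (filterᵇ p xs)

count-++ : {A : Set} (p : A → Bool) (xs ys : List A) → count p (xs ++ ys) ≡ count p xs + count p ys
count-++ p xs ys = trans (cong length (filter-++ (λ x → T? (p x)) xs ys)) (length-++ (filterᵇ p xs))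

count-concatMap : {A B : Set} (p : B → Bool) (g : A → List B) (xs : List A) →
                  count p (concatMap g xs) ≡ sum (map (λ x → count p (g x)) xs)
count-concatMap p g []       = refl
count-concatMap p g (x ∷ xs) = trans (count-++ p (g x) _) (cong (_+_ (count p (g x))) (count-concatMap p g xs))

count-map : {A B : Set} (p : B → Bool) (f : A → B) (xs : List A) →
            count p (map f xs) ≡ count (λ x → p (f x)) xs
count-map p f []       = refl
count-map p f (x ∷ xs) with p (f x)
... | true  = cong suc (count-map p f xs)
... | false = count-map p f xs

count-cong : {A : Set} {p q : A → Bool} → (∀ x → p x ≡ q x) → (xs : List A) → count p xs ≡ count q xs
count-cong {p = p} {q} eq []       = refl
count-cong {p = p} {q} eq (x ∷ xs) with p x | q x | eq x
... | true  | .true  | refl = cong suc (count-cong eq xs)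
... | false | .false | refl = count-cong eq xs

count-false : {A : Set} (xs : List A) → count (λ _ → false) xs ≡ 0
count-false []       = refl
count-false (x ∷ xs) = count-false xs

count-∧ˡ : {A : Set} (b : Bool) (p : A → Bool) (xs : List A) →
           count (λ x → b ∧ p x) xs ≡ (if b then count p xs else 0)
count-∧ˡ true  p xs = refl
count-∧ˡ false p xs = count-false xs

count-singleton : {A : Set} (p : A → Bool) (x : A) → count p (x ∷ []) ≡ (if p x then 1 else 0)
count-singleton p x with p x
... | true  = refl
... | false = refl

-- Walks on the half-line

below : (ℕ → ℕ) → ℕ → ℕ
below f zero    = 0
below f (suc h) = f h

-- lineStep (and stripStep below) is the transfer operator of walks with steps −1, 0, +1:
-- iterating it on g counts walks from a given height, weighted by g at their endpoint.
lineStep : (ℕ → ℕ) → ℕ → ℕ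
lineStep f h = below f h + f h + f (suc h)

lineIter : (ℕ → ℕ) → ℕ → ℕ → ℕ
lineIter g zero    = g
lineIter g (suc k) = lineStep (lineIter g k)

δ₀ : ℕ → ℕ
δ₀ zero    = 1
δ₀ (suc _) = 0

walks : ℕ → ℕ → ℕ
walks = lineIter (λ _ → 1)

walksTo0 : ℕ → ℕ → ℕ
walksTo0 = lineIter δ₀

meander : ℕ → ℕ
meander k = walks k 0

motzkin : ℕ → ℕ
motzkin k = walksTo0 k 0

lineStep-linear : ∀ {f g u : ℕ → ℕ} c → (∀ i → f i + g i ≡ c * u i) →
                  ∀ h → lineStep f h + lineStep g h ≡ c * lineStep u h
lineStep-linear {f} {g} {u} c eq h = begin
  (below f h + f h + f (suc h)) + (below g h + g h + g (suc h))
    ≡⟨ regroup (below f h) (f h) (f (suc h)) (below g h) (g h) (g (suc h)) ⟩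
  (below f h + below g h) + (f h + g h) + (f (suc h) + g (suc h))
    ≡⟨ cong₂ _+_ (cong₂ _+_ (below-linear h) (eq h)) (eq (suc h)) ⟩
  c * below u h + c * u h + c * u (suc h)
    ≡⟨ distrib c (below u h) (u h) (u (suc h)) ⟩
  c * lineStep u h ∎
  where
  regroup : ∀ a b d a′ b′ d′ → (a + b + d) + (a′ + b′ + d′) ≡ (a + a′) + (b + b′) + (d + d′)
  regroup = solve-∀
  distrib : ∀ c a b d → c * a + c * b + c * d ≡ c * (a + b + d)
  distrib = solve-∀
  below-linear : ∀ h → below f h + below g h ≡ c * below u h
  below-linear zero    = sym (*-zeroʳ c)
  below-linear (suc h) = eq h

∑-lineStep : ∀ N (f : ℕ → ℕ) → ∑ (suc N) (lineStep f) + f 0 + f N ≡ 3 * ∑ (suc N) f + f (suc N)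
∑-lineStep N f = begin
  ∑ (suc N) (lineStep f) + f 0 + f N
    ≡⟨ cong (λ s → s + f 0 + f N) ∑-split ⟩
  ∑ N f + S + up + f 0 + f N
    ≡⟨ regroup (∑ N f) S up (f 0) (f N) ⟩
  (∑ N f + f N) + S + (f 0 + up)
    ≡⟨ cong₂ (λ a b → a + S + b) (∑-suc N f) (sym (∑-suc (suc N) f)) ⟨
  S + S + (S + f (suc N))
    ≡⟨ triple S (f (suc N)) ⟩
  3 * S + f (suc N) ∎
  where
  S up : ℕ
  S  = ∑ (suc N) f
  up = ∑ (suc N) (λ i → f (suc i))
  regroup : ∀ a s u b c → a + s + u + b + c ≡ (a + c) + s + (b + u)
  regroup = solve-∀
  triple : ∀ s t → s + s + (s + t) ≡ 3 * s + t
  triple = solve-∀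
  ∑-split : ∑ (suc N) (lineStep f) ≡ ∑ N f + S + up
  ∑-split = trans (∑-+ (suc N) (λ i → below f i + f i) (λ i → f (suc i)))
                  (cong (_+ up) (∑-+ (suc N) (below f) f))

walks-large : ∀ k h → k ≤ h → walks k h ≡ 3 ^ k
walks-large zero    h       _         = refl
walks-large (suc k) (suc h) (s≤s k≤h) = begin
  walks k h + walks k (suc h) + walks k (suc (suc h))
    ≡⟨ cong₂ _+_ (cong₂ _+_ (walks-large k h k≤h) (walks-large k (suc h) (m≤n⇒m≤1+n k≤h)))
                 (walks-large k (suc (suc h)) (m≤n⇒m≤1+n (m≤n⇒m≤1+n k≤h))) ⟩
  3 ^ k + 3 ^ k + 3 ^ k
    ≡⟨ triple (3 ^ k) ⟩
  3 ^ suc k ∎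
  where
  triple : ∀ t → t + t + t ≡ 3 * t
  triple = solve-∀

walksTo0-small : ∀ k h → k < h → walksTo0 k h ≡ 0
walksTo0-small zero    (suc h) _         = refl
walksTo0-small (suc k) (suc h) (s≤s k<h)
  rewrite walksTo0-small k h k<h
        | walksTo0-small k (suc h) (m≤n⇒m≤1+n k<h)
        | walksTo0-small k (suc (suc h)) (m≤n⇒m≤1+n (m≤n⇒m≤1+n k<h)) = refl

walks-extend : ∀ k h → walks (suc k) h + walksTo0 k h ≡ 3 * walks k h
walks-extend zero    zero    = refl
walks-extend zero    (suc h) = refl
walks-extend (suc k) h       = lineStep-linear 3 (walks-extend k) h

∑-walksTo0 : ∀ k N → k ≤ N → ∑ (suc N) (walksTo0 k) ≡ meander k
∑-walksTo0 zero    N       _         = cong suc (trans (∑-const N 0) (*-zeroʳ N))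
∑-walksTo0 (suc k) (suc N) (s≤s k≤N) = +-cancelʳ-≡ (w 0) _ _ (begin
  ∑ (suc (suc N)) (lineStep w) + w 0
    ≡⟨ +-identityʳ _ ⟨
  ∑ (suc (suc N)) (lineStep w) + w 0 + 0
    ≡⟨ cong (_+_ (∑ (suc (suc N)) (lineStep w) + w 0)) (walksTo0-small k (suc N) (s≤s k≤N)) ⟨
  ∑ (suc (suc N)) (lineStep w) + w 0 + w (suc N)
    ≡⟨ ∑-lineStep (suc N) w ⟩
  3 * ∑ (suc (suc N)) w + w (suc (suc N))
    ≡⟨ cong₂ (λ a b → 3 * a + b) (∑-walksTo0 k (suc N) (m≤n⇒m≤1+n k≤N))
                                  (walksTo0-small k (suc (suc N)) (s≤s (m≤n⇒m≤1+n k≤N))) ⟩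
  3 * meander k + 0
    ≡⟨ +-identityʳ _ ⟩
  3 * meander k
    ≡⟨ walks-extend k 0 ⟨
  meander (suc k) + w 0 ∎)
  where
  w : ℕ → ℕ
  w = walksTo0 k

-- exits k = Σ_{x ≥ 0} (3^k − walks k x): the k-step walks on ℤ from a height x ≥ 0 that leave ℕ.
exits : ℕ → ℕ
exits zero    = 0
exits (suc k) = 3 * exits k + meander k

∑-walks+exits : ∀ k N → k ≤ N → ∑ N (walks k) + exits k ≡ N * 3 ^ k
∑-walks+exits zero    N       _         = trans (+-identityʳ _) (∑-const N 1)
∑-walks+exits (suc k) (suc N) (s≤s k≤N) = begin
  ∑ (suc N) (lineStep w) + (3 * exits k + meander k)
    ≡⟨ regroup (∑ (suc N) (lineStep w)) (exits k) (meander k) ⟩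
  (∑ (suc N) (lineStep w) + w 0) + 3 * exits k
    ≡⟨ cong (_+ 3 * exits k) columnSum ⟩
  3 * ∑ (suc N) w + 3 * exits k
    ≡⟨ *-distribˡ-+ 3 (∑ (suc N) w) (exits k) ⟨
  3 * (∑ (suc N) w + exits k)
    ≡⟨ cong (3 *_) (∑-walks+exits k (suc N) (m≤n⇒m≤1+n k≤N)) ⟩
  3 * (suc N * 3 ^ k)
    ≡⟨ *-comm-middle 3 (suc N) (3 ^ k) ⟩
  suc N * 3 ^ suc k ∎
  where
  w : ℕ → ℕ
  w = walks k
  regroup : ∀ s e p → s + (3 * e + p) ≡ (s + p) + 3 * e
  regroup = solve-∀
  *-comm-middle : ∀ a b c → a * (b * c) ≡ b * (a * c)
  *-comm-middle = solve-∀
  columnSum : ∑ (suc N) (lineStep w) + w 0 ≡ 3 * ∑ (suc N) w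
  columnSum = +-cancelʳ-≡ (w N) _ _ (begin
    ∑ (suc N) (lineStep w) + w 0 + w N
      ≡⟨ ∑-lineStep N w ⟩
    3 * ∑ (suc N) w + w (suc N)
      ≡⟨ cong (_+_ (3 * ∑ (suc N) w)) (walks-large k (suc N) (m≤n⇒m≤1+n k≤N)) ⟩
    3 * ∑ (suc N) w + 3 ^ k
      ≡⟨ cong (_+_ (3 * ∑ (suc N) w)) (walks-large k N k≤N) ⟨
    3 * ∑ (suc N) w + w N ∎)

-- Walks in a strip

adjacent : ℕ → ℕ → Bool
adjacent x y = (x ≤ᵇ suc y) ∧ (y ≤ᵇ suc x)

adj≡adjacent : ∀ {m} (a b : Fin m) → adj a b ≡ adjacent (toℕ a) (toℕ b)
adj≡adjacent a b =
  cong₂ _∧_ (isYes≗does (toℕ a ≤? suc (toℕ b))) (isYes≗does (toℕ b ≤? suc (toℕ a)))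

adjacent-suc : ∀ x y → adjacent (suc x) (suc y) ≡ adjacent x y
adjacent-suc x y = cong₂ _∧_ (<ᵇ-suc x (suc y)) (<ᵇ-suc y (suc x))
  where
  <ᵇ-suc : ∀ a n → (a <ᵇ suc n) ≡ (a ≤ᵇ n)
  <ᵇ-suc zero    n = refl
  <ᵇ-suc (suc a) n = refl

stripStep : ℕ → (ℕ → ℕ) → ℕ → ℕ
stripStep m g x = ∑ m (λ y → if adjacent x y then g y else 0)

stripIter : ℕ → (ℕ → ℕ) → ℕ → ℕ → ℕ
stripIter m g zero    = g
stripIter m g (suc k) = stripStep m (stripIter m g k)

whenPos : ℕ → ℕ → ℕ
whenPos zero    v = 0
whenPos (suc r) v = v

stripStep-split : ∀ {m} x r g → suc (x + r) ≡ m →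
                  stripStep m g x ≡ below g x + g x + whenPos r (g (suc x))
stripStep-split zero    zero    g refl = refl
stripStep-split zero    (suc r) g refl =
  trans (cong (λ s → g 0 + (g 1 + s)) (trans (∑-const r 0) (*-zeroʳ r))) (cong (_+_ (g 0)) (+-identityʳ (g 1)))
stripStep-split (suc x) r       g refl = begin
  edge x + ∑ (suc (x + r)) (λ y → if adjacent (suc x) (suc y) then g (suc y) else 0)
    ≡⟨ cong (_+_ (edge x)) (∑-cong (suc (x + r)) (λ y _ →
         cong (λ b → if b then g (suc y) else 0) (adjacent-suc x y))) ⟩
  edge x + stripStep (suc (x + r)) (λ i → g (suc i)) x
    ≡⟨ cong (_+_ (edge x)) (stripStep-split x r (λ i → g (suc i)) refl) ⟩
  edge x + (below (λ i → g (suc i)) x + g (suc x) + whenPos r (g (suc (suc x))))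
    ≡⟨ shift x ⟩
  below g (suc x) + g (suc x) + whenPos r (g (suc (suc x))) ∎
  where
  edge : ℕ → ℕ
  edge y = if adjacent (suc y) 0 then g 0 else 0
  shift : ∀ y → edge y + (below (λ i → g (suc i)) y + g (suc y) + whenPos r (g (suc (suc y))))
                ≡ below g (suc y) + g (suc y) + whenPos r (g (suc (suc y)))
  shift zero    = sym (+-assoc (g 0) (g 1) _)
  shift (suc y) = refl

-- r is the number of rows above x. Since k < m no walk leaves the strip on both sides, so
-- this is inclusion–exclusion against walks on ℕ and on its mirror image.
stripIter-walks : ∀ {m} k x r → suc (x + r) ≡ m → k < m →
                   stripIter m (λ _ → 1) k x + 3 ^ k ≡ walks k x + walks k r
stripIter-walks         zero    x r _  _    = refl
stripIter-walks {m = m} (suc k) x r eq sk<m = begin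
  stripStep m Q x + 3 ^ suc k
    ≡⟨ cong (_+ 3 ^ suc k) (stripStep-split x r Q eq) ⟩
  below Q x + Q x + whenPos r (Q (suc x)) + 3 * 3 ^ k
    ≡⟨ spread (below Q x) (Q x) (whenPos r (Q (suc x))) (3 ^ k) ⟩
  (below Q x + 3 ^ k) + (Q x + 3 ^ k) + (whenPos r (Q (suc x)) + 3 ^ k)
    ≡⟨ cong₂ _+_ (cong₂ _+_ (lower x eq) (stripIter-walks k x r eq k<m)) (upper r eq) ⟩
  (below W x + W (suc r)) + (W x + W r) + (W (suc x) + below W r)
    ≡⟨ regroup (below W x) (W x) (W (suc x)) (below W r) (W r) (W (suc r)) ⟩
  lineStep W x + lineStep W r ∎
  where
  Q W : ℕ → ℕ
  Q = stripIter m (λ _ → 1) k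
  W = walks k
  k<m : k < m
  k<m = <-trans (n<1+n k) sk<m
  spread : ∀ a b c t → a + b + c + 3 * t ≡ (a + t) + (b + t) + (c + t)
  spread = solve-∀
  regroup : ∀ a b c a′ b′ c′ → (a + c′) + (b + b′) + (c + a′) ≡ (a + b + c) + (a′ + b′ + c′)
  regroup = solve-∀
  lower : ∀ x → suc (x + r) ≡ m → below Q x + 3 ^ k ≡ below W x + W (suc r)
  lower zero    eq = sym (walks-large k (suc r) (<⇒≤ (subst (k <_) (sym eq) k<m)))
  lower (suc x) eq = stripIter-walks k x (suc r) (trans (cong suc (+-suc x r)) eq) k<m
  upper : ∀ r → suc (x + r) ≡ m → whenPos r (Q (suc x)) + 3 ^ k ≡ W (suc x) + below W r
  upper zero    eq = sym (trans (+-identityʳ _) (walks-large k (suc x) (<⇒≤ k<sx)))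
    where
    k<sx : k < suc x
    k<sx = subst (λ y → k < suc y) (+-identityʳ x) (subst (k <_) (sym eq) k<m)
  upper (suc r) eq = stripIter-walks k (suc x) r (trans (cong suc (sym (+-suc x r))) eq) k<m

-- A walk that reaches row m needs more than m + r steps to get back to row 0.
stripIter-walksTo0 : ∀ {m} k x r → suc (x + r) ≡ m → k ≤ m + r →
                     stripIter m δ₀ k x ≡ walksTo0 k x
stripIter-walksTo0         zero    x r _  _     = refl
stripIter-walksTo0 {m = m} (suc k) x r eq sk≤m+r = begin
  stripStep m E x
    ≡⟨ stripStep-split x r E eq ⟩
  below E x + E x + whenPos r (E (suc x))
    ≡⟨ cong₂ _+_ (cong₂ _+_ (lower x eq) (stripIter-walksTo0 k x r eq k≤m+r)) (upper r eq sk≤m+r) ⟩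
  lineStep Z x ∎
  where
  E Z : ℕ → ℕ
  E = stripIter m δ₀ k
  Z = walksTo0 k
  k≤m+r : k ≤ m + r
  k≤m+r = <⇒≤ sk≤m+r
  lower : ∀ x → suc (x + r) ≡ m → below E x ≡ below Z x
  lower zero    eq = refl
  lower (suc x) eq = stripIter-walksTo0 k x (suc r) (trans (cong suc (+-suc x r)) eq)
                                      (≤-trans k≤m+r (+-monoʳ-≤ m (n≤1+n r)))
  upper : ∀ r → suc (x + r) ≡ m → suc k ≤ m + r → whenPos r (E (suc x)) ≡ Z (suc x)
  upper zero    eq b = sym (walksTo0-small k (suc x) (subst (suc k ≤_) m+0≡1+x b))
    where
    m+0≡1+x : m + 0 ≡ suc x
    m+0≡1+x = trans (+-identityʳ m) (trans (sym eq) (cong suc (+-identityʳ x)))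
  upper (suc r) eq b = stripIter-walksTo0 k (suc x) r (trans (cong suc (sym (+-suc x r))) eq)
                                         (≤-pred (subst (suc k ≤_) (+-suc m r) b))

-- Admissible sequences and Motzkin paths as walks

module _ {m : ℕ} (e : ∀ {k} → Vec (Fin m) (suc k) → Bool) (g : ℕ → ℕ)
         (e-tail : ∀ {k} x y (v : Vec (Fin m) k) → e (x ∷ y ∷ v) ≡ e (y ∷ v))
         (e-base : ∀ x → (if e (x ∷ []) then 1 else 0) ≡ g (toℕ x)) where

  count-admissible-from : ∀ k x → count (λ v → admissible (x ∷ v) ∧ e (x ∷ v)) (allVecs m k)
                                  ≡ stripIter m g k (toℕ x)
  count-admissible-from zero    x =
    trans (count-singleton (λ v → admissible (x ∷ v) ∧ e (x ∷ v)) []) (e-base x)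
  count-admissible-from (suc k) x = begin
    count p (concatMap (λ y → map (y ∷_) (allVecs m k)) (allFin m))
      ≡⟨ count-concatMap p _ (allFin m) ⟩
    sum (map (λ y → count p (map (y ∷_) (allVecs m k))) (allFin m))
      ≡⟨ sum-allFin m _ _ extend ⟩
    stripStep m (stripIter m g k) (toℕ x) ∎
    where
    p : Vec (Fin m) (suc k) → Bool
    p v = admissible (x ∷ v) ∧ e (x ∷ v)
    extend : ∀ y → count p (map (y ∷_) (allVecs m k))
                   ≡ (if adjacent (toℕ x) (toℕ y) then stripIter m g k (toℕ y) else 0)
    extend y = begin
      count p (map (y ∷_) (allVecs m k))
        ≡⟨ count-map p (y ∷_) (allVecs m k) ⟩
      count (λ v → (adj x y ∧ admissible (y ∷ v)) ∧ e (x ∷ y ∷ v)) (allVecs m k)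
        ≡⟨ count-cong (λ v → trans (∧-assoc (adj x y) _ _)
                                   (cong (λ b → adj x y ∧ (admissible (y ∷ v) ∧ b)) (e-tail x y v))) (allVecs m k) ⟩
      count (λ v → adj x y ∧ (admissible (y ∷ v) ∧ e (y ∷ v))) (allVecs m k)
        ≡⟨ count-∧ˡ (adj x y) (λ v → admissible (y ∷ v) ∧ e (y ∷ v)) (allVecs m k) ⟩
      (if adj x y then count (λ v → admissible (y ∷ v) ∧ e (y ∷ v)) (allVecs m k) else 0)
        ≡⟨ cong₂ (λ b n → if b then n else 0) (adj≡adjacent x y) (count-admissible-from k y) ⟩
      (if adjacent (toℕ x) (toℕ y) then stripIter m g k (toℕ y) else 0) ∎

  count-admissible : ∀ k → count (λ v → admissible v ∧ e v) (allVecs m (suc k)) ≡ ∑ m (stripIter m g k)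
  count-admissible k = trans (count-concatMap _ (λ x → map (x ∷_) (allVecs m k)) (allFin m))
    (sum-allFin m _ _ (λ x → trans (count-map _ (x ∷_) (allVecs m k)) (count-admissible-from k x)))

I≡∑stripIter : ∀ m k → I m (suc k) ≡ ∑ m (stripIter m (λ _ → 1) k)
I≡∑stripIter m k = trans (count-cong (λ v → sym (∧-identityʳ (admissible v))) (allVecs m (suc k)))
  (count-admissible {m = m} (λ _ → true) (λ _ → 1) (λ _ _ _ → refl) (λ _ → refl) k)

D≡∑stripIter : ∀ m s → D (suc m) (suc s) zero ≡ ∑ (suc m) (stripIter (suc m) δ₀ s)
D≡∑stripIter m = count-admissible (endsAt zero) δ₀ (λ _ _ _ → refl) endsAt-zero
  where
  endsAt-zero : ∀ x → (if endsAt zero (x ∷ []) then 1 else 0) ≡ δ₀ (toℕ x)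
  endsAt-zero zero    = refl
  endsAt-zero (suc x) = refl

count-motzkinFrom : ∀ k h → count (motzkinFrom h) (allSteps k) ≡ walksTo0 k h
count-motzkinFrom zero    zero    = refl
count-motzkinFrom zero    (suc h) = refl
count-motzkinFrom (suc k) h = begin
  count (motzkinFrom h) (allSteps (suc k))
    ≡⟨ count-concatMap (motzkinFrom h) (λ s → map (s ∷_) (allSteps k)) (U ∷ Dn ∷ F ∷ []) ⟩
  count (motzkinFrom h) (map (U ∷_) (allSteps k))
    + (count (motzkinFrom h) (map (Dn ∷_) (allSteps k)) + (count (motzkinFrom h) (map (F ∷_) (allSteps k)) + 0))
    ≡⟨ cong₂ _+_ (trans (count-map _ _ (allSteps k)) (up h))
                 (cong₂ _+_ (trans (count-map _ _ (allSteps k)) (down h))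
                            (cong (_+ 0) (trans (count-map _ _ (allSteps k)) (flat h)))) ⟩
  Z (suc h) + (below Z h + (Z h + 0))
    ≡⟨ rotate (Z (suc h)) (below Z h) (Z h) ⟩
  lineStep Z h ∎
  where
  Z : ℕ → ℕ
  Z = walksTo0 k
  rotate : ∀ a b c → a + (b + (c + 0)) ≡ b + c + a
  rotate = solve-∀
  up : ∀ h → count (λ s → motzkinFrom h (U ∷ s)) (allSteps k) ≡ Z (suc h)
  up zero    = count-motzkinFrom k 1
  up (suc h) = count-motzkinFrom k (suc (suc h))
  down : ∀ h → count (λ s → motzkinFrom h (Dn ∷ s)) (allSteps k) ≡ below Z h
  down zero    = count-false (allSteps k)
  down (suc h) = count-motzkinFrom k h
  flat : ∀ h → count (λ s → motzkinFrom h (F ∷ s)) (allSteps k) ≡ Z h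
  flat zero    = count-motzkinFrom k 0
  flat (suc h) = count-motzkinFrom k (suc h)

Motzkin≡motzkin : ∀ k → Motzkin k ≡ motzkin k
Motzkin≡motzkin k = count-motzkinFrom k 0

-- Meanders and Motzkin numbers

conv : (ℕ → ℕ) → (ℕ → ℕ) → ℕ → ℕ
conv f g zero    = f 0 * g 0
conv f g (suc k) = f (suc k) * g 0 + conv f (λ t → g (suc t)) k

conv-congʳ : ∀ f {g g′ : ℕ → ℕ} k → (∀ t → t ≤ k → g t ≡ g′ t) → conv f g k ≡ conv f g′ k
conv-congʳ f zero    eq = cong (f 0 *_) (eq 0 z≤n)
conv-congʳ f (suc k) eq =
  cong₂ _+_ (cong (f (suc k) *_) (eq 0 z≤n)) (conv-congʳ f k (λ t t≤k → eq (suc t) (s≤s t≤k)))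

conv-+ʳ : ∀ (f g h : ℕ → ℕ) k → conv f (λ t → g t + h t) k ≡ conv f g k + conv f h k
conv-+ʳ f g h zero    = *-distribˡ-+ (f 0) (g 0) (h 0)
conv-+ʳ f g h (suc k) = begin
  f (suc k) * (g 0 + h 0) + conv f (λ t → g (suc t) + h (suc t)) k
    ≡⟨ cong₂ _+_ (*-distribˡ-+ (f (suc k)) (g 0) (h 0)) (conv-+ʳ f _ _ k) ⟩
  f (suc k) * g 0 + f (suc k) * h 0 + (conv f _ k + conv f _ k)
    ≡⟨ +-assoc-middle (f (suc k) * g 0) (f (suc k) * h 0) _ _ ⟩
  f (suc k) * g 0 + conv f _ k + (f (suc k) * h 0 + conv f _ k) ∎
  where
  +-assoc-middle : ∀ a b c d → a + b + (c + d) ≡ a + c + (b + d)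
  +-assoc-middle = solve-∀

conv-*ʳ : ∀ (f : ℕ → ℕ) c (g : ℕ → ℕ) k → conv f (λ t → c * g t) k ≡ c * conv f g k
conv-*ʳ f c g zero    = *-comm-middle (f 0) c (g 0)
  where
  *-comm-middle : ∀ a c b → a * (c * b) ≡ c * (a * b)
  *-comm-middle = solve-∀
conv-*ʳ f c g (suc k) = trans (cong (_+_ (f (suc k) * (c * g 0))) (conv-*ʳ f c _ k)) (factor (f (suc k)) c (g 0) _)
  where
  factor : ∀ a c b d → a * (c * b) + c * d ≡ c * (a * b + d)
  factor = solve-∀

conv-∑ʳ : ∀ N (f : ℕ → ℕ) (G : ℕ → ℕ → ℕ) k →
          ∑ N (λ e → conv f (λ t → G t e) k) ≡ conv f (λ t → ∑ N (G t)) k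
conv-∑ʳ zero    f G k = sym (conv-*ʳ f 0 (λ _ → 1) k)  -- λ _ → 0 is 0 times λ _ → 1
conv-∑ʳ (suc N) f G k = trans (cong (_+_ (conv f (λ t → G t 0) k)) (conv-∑ʳ N f (λ t e → G t (suc e)) k))
  (sym (conv-+ʳ f (λ t → G t 0) (λ t → ∑ N (λ e → G t (suc e))) k))

conv≡∑ : ∀ (f g : ℕ → ℕ) k → conv f g k ≡ ∑ (suc k) (λ i → f i * g (k ∸ i))
conv≡∑ f g zero    = sym (+-identityʳ _)
conv≡∑ f g (suc k) = begin
  f (suc k) * g 0 + conv f (λ t → g (suc t)) k
    ≡⟨ cong (_+_ (f (suc k) * g 0)) (conv≡∑ f _ k) ⟩
  f (suc k) * g 0 + ∑ (suc k) (λ i → f i * g (suc (k ∸ i)))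
    ≡⟨ cong (_+_ (f (suc k) * g 0)) (∑-cong (suc k) (λ i i<sk →
         cong (λ j → f i * g j) (sym (+-∸-assoc 1 (≤-pred i<sk))))) ⟩
  f (suc k) * g 0 + ∑ (suc k) (λ i → f i * g (suc k ∸ i))
    ≡⟨ +-comm (f (suc k) * g 0) _ ⟩
  ∑ (suc k) (λ i → f i * g (suc k ∸ i)) + f (suc k) * g 0
    ≡⟨ cong (λ j → ∑ (suc k) (λ i → f i * g (suc k ∸ i)) + f (suc k) * g j) (n∸n≡0 k) ⟨
  ∑ (suc k) (λ i → f i * g (suc k ∸ i)) + f (suc k) * g (suc k ∸ suc k)
    ≡⟨ ∑-suc (suc k) (λ i → f i * g (suc k ∸ i)) ⟨
  ∑ (suc (suc k)) (λ i → f i * g (suc k ∸ i)) ∎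

conv-comm : ∀ (f g : ℕ → ℕ) k → conv f g k ≡ conv g f k
conv-comm f g k = trans (conv≡∑ f g k) (trans (∑-reflect (suc k) _ _ swap) (sym (conv≡∑ g f k)))
  where
  swap : ∀ x r → suc (x + r) ≡ suc k → f x * g (k ∸ x) ≡ g r * f (k ∸ r)
  swap x r eq rewrite sym (suc-injective eq) | m+n∸m≡n x r | m+n∸n≡m x r = *-comm (f x) (g r)

-- First passage from e + 1 to e: a Motzkin path of length i at level e + 1, a down-step,
-- then k − i steps from e to 0.
walksTo0-conv : ∀ k e → walksTo0 (suc k) (suc e) ≡ conv motzkin (λ t → walksTo0 t e) k
walksTo0-conv zero    zero    = refl
walksTo0-conv zero    (suc e) = refl
walksTo0-conv (suc k) zero    = begin
  motzkin (suc k) + Z (suc k) 1 + Z (suc k) 2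
    ≡⟨ cong₂ (λ a b → motzkin (suc k) + a + b) (walksTo0-conv k 0) (walksTo0-conv k 1) ⟩
  motzkin (suc k) + conv motzkin (λ t → Z t 0) k + conv motzkin (λ t → Z t 1) k
    ≡⟨ +-assoc (motzkin (suc k)) _ _ ⟩
  motzkin (suc k) + (conv motzkin (λ t → Z t 0) k + conv motzkin (λ t → Z t 1) k)
    ≡⟨ cong₂ _+_ (*-identityʳ (motzkin (suc k))) (conv-+ʳ motzkin (λ t → Z t 0) (λ t → Z t 1) k) ⟨
  motzkin (suc k) * 1 + conv motzkin (λ t → Z t 0 + Z t 1) k ∎
  where
  Z : ℕ → ℕ → ℕ
  Z = walksTo0
walksTo0-conv (suc k) (suc e) = begin
  Z (suc k) (suc e) + Z (suc k) (suc (suc e)) + Z (suc k) (suc (suc (suc e)))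
    ≡⟨ cong₂ _+_ (cong₂ _+_ (walksTo0-conv k e) (walksTo0-conv k (suc e))) (walksTo0-conv k (suc (suc e))) ⟩
  conv motzkin (λ t → Z t e) k + conv motzkin (λ t → Z t (suc e)) k + conv motzkin (λ t → Z t (suc (suc e))) k
    ≡⟨ cong (_+ conv motzkin (λ t → Z t (suc (suc e))) k) (conv-+ʳ motzkin (λ t → Z t e) (λ t → Z t (suc e)) k) ⟨
  conv motzkin (λ t → Z t e + Z t (suc e)) k + conv motzkin (λ t → Z t (suc (suc e))) k
    ≡⟨ conv-+ʳ motzkin (λ t → Z t e + Z t (suc e)) (λ t → Z t (suc (suc e))) k ⟨
  conv motzkin (λ t → lineStep (Z t) (suc e)) k
    ≡⟨ cong (_+ conv motzkin (λ t → lineStep (Z t) (suc e)) k) (*-zeroʳ (motzkin (suc k))) ⟨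
  motzkin (suc k) * 0 + conv motzkin (λ t → lineStep (Z t) (suc e)) k ∎
  where
  Z : ℕ → ℕ → ℕ
  Z = walksTo0

meander-suc : ∀ k → meander (suc k) ≡ motzkin (suc k) + conv motzkin meander k
meander-suc k = begin
  meander (suc k)
    ≡⟨ ∑-walksTo0 (suc k) (suc k) ≤-refl ⟨
  motzkin (suc k) + ∑ (suc k) (λ i → walksTo0 (suc k) (suc i))
    ≡⟨ cong (_+_ (motzkin (suc k))) (∑-cong (suc k) (λ i _ → walksTo0-conv k i)) ⟩
  motzkin (suc k) + ∑ (suc k) (λ i → conv motzkin (λ t → walksTo0 t i) k)
    ≡⟨ cong (_+_ (motzkin (suc k))) (conv-∑ʳ (suc k) motzkin walksTo0 k) ⟩
  motzkin (suc k) + conv motzkin (λ t → ∑ (suc k) (walksTo0 t)) k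
    ≡⟨ cong (_+_ (motzkin (suc k))) (conv-congʳ motzkin k (λ t t≤k → ∑-walksTo0 t k t≤k)) ⟩
  motzkin (suc k) + conv motzkin meander k ∎

conv-meander-meander : ∀ k → conv meander meander k ≡ conv motzkin (3 ^_) k
conv-meander-meander zero    = refl
conv-meander-meander (suc k) = +-cancelʳ-≡ (conv meander motzkin k) _ _ (begin
  meander (suc k) * 1 + conv meander (λ t → meander (suc t)) k + conv meander motzkin k
    ≡⟨ +-assoc (meander (suc k) * 1) _ _ ⟩
  meander (suc k) * 1 + (conv meander (λ t → meander (suc t)) k + conv meander motzkin k)
    ≡⟨ cong₂ _+_ (sym (*-identityʳ (meander (suc k)))) (conv-+ʳ meander (λ t → meander (suc t)) motzkin k) ⟨
  meander (suc k) + conv meander (λ t → meander (suc t) + motzkin t) k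
    ≡⟨ cong (_+_ (meander (suc k))) (conv-congʳ meander k (λ t _ → walks-extend t 0)) ⟩
  meander (suc k) + conv meander (λ t → 3 * meander t) k
    ≡⟨ cong₂ _+_ (meander-suc k) (trans (conv-*ʳ meander 3 meander k) (cong (3 *_) (conv-meander-meander k))) ⟩
  motzkin (suc k) + conv motzkin meander k + 3 * conv motzkin (3 ^_) k
    ≡⟨ cong (λ c → motzkin (suc k) + c + 3 * conv motzkin (3 ^_) k) (conv-comm motzkin meander k) ⟩
  motzkin (suc k) + conv meander motzkin k + 3 * conv motzkin (3 ^_) k
    ≡⟨ regroup (motzkin (suc k)) (conv meander motzkin k) (conv motzkin (3 ^_) k) ⟩
  motzkin (suc k) * 1 + 3 * conv motzkin (3 ^_) k + conv meander motzkin k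
    ≡⟨ cong (λ c → motzkin (suc k) * 1 + c + conv meander motzkin k) (conv-*ʳ motzkin 3 (3 ^_) k) ⟨
  motzkin (suc k) * 1 + conv motzkin (λ t → 3 * 3 ^ t) k + conv meander motzkin k ∎)
  where
  regroup : ∀ a b c → a + b + 3 * c ≡ a * 1 + 3 * c + b
  regroup = solve-∀

conv-motzkin-pow3 : ∀ k → conv motzkin (3 ^_) k + meander (suc k) ≡ 3 ^ suc k
conv-motzkin-pow3 zero    = refl
conv-motzkin-pow3 (suc k) = begin
  motzkin (suc k) * 1 + conv motzkin (λ t → 3 * 3 ^ t) k + meander (suc (suc k))
    ≡⟨ cong (λ c → motzkin (suc k) * 1 + c + meander (suc (suc k))) (conv-*ʳ motzkin 3 (3 ^_) k) ⟩
  motzkin (suc k) * 1 + 3 * conv motzkin (3 ^_) k + meander (suc (suc k))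
    ≡⟨ regroup (motzkin (suc k)) (conv motzkin (3 ^_) k) (meander (suc (suc k))) ⟩
  3 * conv motzkin (3 ^_) k + (meander (suc (suc k)) + motzkin (suc k))
    ≡⟨ cong (_+_ (3 * conv motzkin (3 ^_) k)) (walks-extend (suc k) 0) ⟩
  3 * conv motzkin (3 ^_) k + 3 * meander (suc k)
    ≡⟨ *-distribˡ-+ 3 (conv motzkin (3 ^_) k) _ ⟨
  3 * (conv motzkin (3 ^_) k + meander (suc k))
    ≡⟨ cong (3 *_) (conv-motzkin-pow3 k) ⟩
  3 * 3 ^ suc k ∎
  where
  regroup : ∀ a b c → a * 1 + 3 * b + c ≡ 3 * b + (c + a)
  regroup = solve-∀

D∞ : ℕ → ℕ
D∞ zero    = 1
D∞ (suc i) = meander i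

∑-D∞-D∞ : ∀ k → ∑ (suc k) (λ i → D∞ i * D∞ (suc k ∸ i)) ≡ 3 ^ k
∑-D∞-D∞ zero    = refl
∑-D∞-D∞ (suc k) = begin
  1 * meander (suc k) + ∑ (suc k) (λ i → meander i * D∞ (suc k ∸ i))
    ≡⟨ cong₂ _+_ (*-identityˡ (meander (suc k))) (∑-cong (suc k) (λ i i<sk →
         cong (λ j → meander i * D∞ j) (+-∸-assoc 1 (≤-pred i<sk)))) ⟩
  meander (suc k) + ∑ (suc k) (λ i → meander i * meander (k ∸ i))
    ≡⟨ cong (_+_ (meander (suc k))) (trans (sym (conv≡∑ meander meander k)) (conv-meander-meander k)) ⟩
  meander (suc k) + conv motzkin (3 ^_) k
    ≡⟨ +-comm (meander (suc k)) _ ⟩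
  conv motzkin (3 ^_) k + meander (suc k)
    ≡⟨ conv-motzkin-pow3 k ⟩
  3 ^ suc k ∎

weightedMotzkin : ℕ → ℕ
weightedMotzkin a = ∑ a (λ j → (a ∸ j) * 3 ^ (a ∸ suc j) * motzkin j)

weightedMotzkin-suc : ∀ a → weightedMotzkin (suc a) ≡ 3 * weightedMotzkin a + conv motzkin (3 ^_) a
weightedMotzkin-suc a = begin
  ∑ (suc a) (λ j → (suc a ∸ j) * 3 ^ (a ∸ j) * motzkin j)
    ≡⟨ ∑-suc a _ ⟩
  ∑ a (λ j → (suc a ∸ j) * 3 ^ (a ∸ j) * motzkin j) + (suc a ∸ a) * 3 ^ (a ∸ a) * motzkin a
    ≡⟨ cong₂ _+_ (∑-cong a split) (cong (λ d → d * 3 ^ (a ∸ a) * motzkin a) (m+n∸n≡m 1 a)) ⟩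
  ∑ a (λ j → 3 * ((a ∸ j) * 3 ^ (a ∸ suc j) * motzkin j) + motzkin j * 3 ^ (a ∸ j)) + 1 * 3 ^ (a ∸ a) * motzkin a
    ≡⟨ cong (_+ 1 * 3 ^ (a ∸ a) * motzkin a)
            (trans (∑-+ a _ _) (cong (_+ ∑ a (λ j → motzkin j * 3 ^ (a ∸ j))) (∑-*ˡ a 3 _))) ⟩
  3 * weightedMotzkin a + ∑ a (λ j → motzkin j * 3 ^ (a ∸ j)) + 1 * 3 ^ (a ∸ a) * motzkin a
    ≡⟨ reassoc (3 * weightedMotzkin a) _ (3 ^ (a ∸ a)) (motzkin a) ⟩
  3 * weightedMotzkin a + (∑ a (λ j → motzkin j * 3 ^ (a ∸ j)) + motzkin a * 3 ^ (a ∸ a))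
    ≡⟨ cong (_+_ (3 * weightedMotzkin a))
            (trans (conv≡∑ motzkin (3 ^_) a) (∑-suc a (λ j → motzkin j * 3 ^ (a ∸ j)))) ⟨
  3 * weightedMotzkin a + conv motzkin (3 ^_) a ∎
  where
  reassoc : ∀ x y p q → x + y + 1 * p * q ≡ x + (y + q * p)
  reassoc = solve-∀
  split : ∀ j → j < a → (suc a ∸ j) * 3 ^ (a ∸ j) * motzkin j
                        ≡ 3 * ((a ∸ j) * 3 ^ (a ∸ suc j) * motzkin j) + motzkin j * 3 ^ (a ∸ j)
  split j j<a rewrite +-∸-assoc 1 (<⇒≤ j<a) | +-∸-assoc 1 j<a = shape (a ∸ suc j) (3 ^ (a ∸ suc j)) (motzkin j)
    where
    shape : ∀ d t μ → suc (suc d) * (3 * t) * μ ≡ 3 * (suc d * t * μ) + μ * (3 * t)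
    shape = solve-∀

weightedMotzkin+exits : ∀ a → weightedMotzkin a + exits (suc a) ≡ suc a * 3 ^ a
weightedMotzkin+exits zero    = refl
weightedMotzkin+exits (suc a) = begin
  weightedMotzkin (suc a) + (3 * exits (suc a) + meander (suc a))
    ≡⟨ cong (_+ (3 * exits (suc a) + meander (suc a))) (weightedMotzkin-suc a) ⟩
  3 * weightedMotzkin a + conv motzkin (3 ^_) a + (3 * exits (suc a) + meander (suc a))
    ≡⟨ regroup (weightedMotzkin a) (conv motzkin (3 ^_) a) (exits (suc a)) (meander (suc a)) ⟩
  3 * (weightedMotzkin a + exits (suc a)) + (conv motzkin (3 ^_) a + meander (suc a))
    ≡⟨ cong₂ (λ u v → 3 * u + v) (weightedMotzkin+exits a) (conv-motzkin-pow3 a) ⟩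
  3 * (suc a * 3 ^ a) + 3 ^ suc a
    ≡⟨ collect a (3 ^ a) ⟩
  suc (suc a) * 3 ^ suc a ∎
  where
  regroup : ∀ w c e p → 3 * w + c + (3 * e + p) ≡ 3 * (w + e) + (c + p)
  regroup = solve-∀
  collect : ∀ a t → 3 * (suc a * t) + 3 * t ≡ suc (suc a) * (3 * t)
  collect = solve-∀

I+2exits : ∀ m k → k < m → I m (suc k) + 2 * exits k ≡ m * 3 ^ k
I+2exits m k k<m = +-cancelʳ-≡ (m * 3 ^ k) _ _ (begin
  I m (suc k) + 2 * exits k + m * 3 ^ k
    ≡⟨ cong (λ i → i + 2 * exits k + m * 3 ^ k) (I≡∑stripIter m k) ⟩
  ∑ m Q + 2 * exits k + m * 3 ^ k
    ≡⟨ regroup (∑ m Q) (exits k) (m * 3 ^ k) ⟩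
  (∑ m Q + m * 3 ^ k) + 2 * exits k
    ≡⟨ cong (_+ 2 * exits k) inclusion-exclusion ⟩
  (S + S) + 2 * exits k
    ≡⟨ double S (exits k) ⟩
  2 * (S + exits k)
    ≡⟨ cong (2 *_) (∑-walks+exits k m (<⇒≤ k<m)) ⟩
  2 * (m * 3 ^ k)
    ≡⟨ double′ (m * 3 ^ k) ⟩
  m * 3 ^ k + m * 3 ^ k ∎)
  where
  Q : ℕ → ℕ
  Q = stripIter m (λ _ → 1) k
  S : ℕ
  S = ∑ m (walks k)
  regroup : ∀ q e t → q + 2 * e + t ≡ (q + t) + 2 * e
  regroup = solve-∀
  double : ∀ s e → (s + s) + 2 * e ≡ 2 * (s + e)
  double = solve-∀
  double′ : ∀ t → 2 * t ≡ t + t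
  double′ = solve-∀
  inclusion-exclusion : ∑ m Q + m * 3 ^ k ≡ S + S
  inclusion-exclusion = begin
    ∑ m Q + m * 3 ^ k
      ≡⟨ trans (∑-+ m Q (λ _ → 3 ^ k)) (cong (_+_ (∑ m Q)) (∑-const m (3 ^ k))) ⟨
    ∑ m (λ x → Q x + 3 ^ k)
      ≡⟨ ∑-cong m (λ x x<m → stripIter-walks k x (m ∸ suc x) (m+[n∸m]≡n x<m) k<m) ⟩
    ∑ m (λ x → walks k x + walks k (m ∸ suc x))
      ≡⟨ ∑-+ m (walks k) (λ x → walks k (m ∸ suc x)) ⟩
    S + ∑ m (λ x → walks k (m ∸ suc x))
      ≡⟨ cong (_+_ S) (∑-reflect m _ (walks k) (λ x r eq →
           cong (walks k) (trans (cong (_∸ suc x) (sym eq)) (m+n∸m≡n (suc x) r)))) ⟩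
    S + S ∎

D≡D∞ : ∀ m j → j ≤ suc m → D (suc m) j zero ≡ D∞ j
D≡D∞ m zero    _         = refl
D≡D∞ m (suc s) (s≤s s≤m) = begin
  D (suc m) (suc s) zero
    ≡⟨ D≡∑stripIter m s ⟩
  ∑ (suc m) (stripIter (suc m) δ₀ s)
    ≡⟨ ∑-cong (suc m) (λ x x<m → stripIter-walksTo0 s x (m ∸ x) (cong suc (m+[n∸m]≡n (≤-pred x<m)))
                                   (≤-trans (m≤n⇒m≤1+n s≤m) (m≤m+n (suc m) (m ∸ x)))) ⟩
  ∑ (suc m) (walksTo0 s)
    ≡⟨ ∑-walksTo0 s m s≤m ⟩
  meander s ∎

sumTo-D-D : ∀ m k → k ≤ m → sumTo (suc k) (λ i → D (suc m) i zero * D (suc m) (suc k ∸ i) zero) ≡ 3 ^ k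
sumTo-D-D m k k≤m = begin
  sumTo (suc k) (λ i → D (suc m) i zero * D (suc m) (suc k ∸ i) zero)
    ≡⟨ sumTo≡∑ (suc k) _ ⟩
  ∑ (suc k) (λ i → D (suc m) i zero * D (suc m) (suc k ∸ i) zero)
    ≡⟨ ∑-cong (suc k) (λ i i<sk → cong₂ _*_ (D≡D∞ m i (≤-trans (<⇒≤ i<sk) (s≤s k≤m)))
                                             (D≡D∞ m (suc k ∸ i) (≤-trans (m∸n≤m (suc k) i) (s≤s k≤m)))) ⟩
  ∑ (suc k) (λ i → D∞ i * D∞ (suc k ∸ i))
    ≡⟨ ∑-D∞-D∞ k ⟩
  3 ^ k ∎

sumTo-weightedMotzkin : ∀ a → sumTo a (λ k → (2 + a ∸ k ∸ 2) * 3 ^ (2 + a ∸ k ∸ 3) * Motzkin k)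
                              ≡ weightedMotzkin a
sumTo-weightedMotzkin a = trans (sumTo≡∑ a _) (∑-cong a (λ j _ →
  trans (cong₂ (λ d e → d * 3 ^ e * Motzkin j) (drop2 j) (drop3 j))
        (cong ((a ∸ j) * 3 ^ (a ∸ suc j) *_) (Motzkin≡motzkin j))))
  where
  drop2 : ∀ j → 2 + a ∸ j ∸ 2 ≡ a ∸ j
  drop2 j = trans (∸-+-assoc (2 + a) j 2) (cong (2 + a ∸_) (+-comm j 2))
  drop3 : ∀ j → 2 + a ∸ j ∸ 3 ≡ a ∸ suc j
  drop3 j = trans (∸-+-assoc (2 + a) j 3) (cong (2 + a ∸_) (+-comm j 3))

I-formula : ∀ m a → 2 + a ≤ m →
            I m (2 + a) ≡ (2 + a + 2) * 3 ^ a + ((m ∸ (2 + a)) * 3 ^ suc a + 2 * weightedMotzkin a)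
I-formula m a n≤m = +-cancelʳ-≡ (2 * exits (suc a)) _ _ (begin
  I m (2 + a) + 2 * exits (suc a)
    ≡⟨ I+2exits m (suc a) n≤m ⟩
  m * 3 ^ suc a
    ≡⟨ cong (_* 3 ^ suc a) (m+[n∸m]≡n n≤m) ⟨
  (2 + a + d) * 3 ^ suc a
    ≡⟨ expand a d (3 ^ a) ⟩
  (2 + a + 2) * 3 ^ a + d * 3 ^ suc a + 2 * (suc a * 3 ^ a)
    ≡⟨ cong (λ w → (2 + a + 2) * 3 ^ a + d * 3 ^ suc a + 2 * w) (weightedMotzkin+exits a) ⟨
  (2 + a + 2) * 3 ^ a + d * 3 ^ suc a + 2 * (weightedMotzkin a + exits (suc a))
    ≡⟨ regroup ((2 + a + 2) * 3 ^ a) (d * 3 ^ suc a) (weightedMotzkin a) (exits (suc a)) ⟩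
  (2 + a + 2) * 3 ^ a + (d * 3 ^ suc a + 2 * weightedMotzkin a) + 2 * exits (suc a) ∎)
  where
  d : ℕ
  d = m ∸ (2 + a)
  expand : ∀ a d t → (2 + a + d) * (3 * t) ≡ (2 + a + 2) * t + d * (3 * t) + 2 * (suc a * t)
  expand = solve-∀
  regroup : ∀ p q w e → p + q + 2 * (w + e) ≡ p + (q + 2 * w) + 2 * e
  regroup = solve-∀

ℕ→ℚ≡mkℚ : ∀ a → ℕ→ℚ a ≡ mkℚ (+ a) 0 (Coprime.sym (1-coprimeTo a))
ℕ→ℚ≡mkℚ a = normalize-coprime (Coprime.sym (1-coprimeTo a))

ℕ→ℚ-+ : ∀ a b → ℕ→ℚ (a + b) ≡ ℕ→ℚ a +ℚ ℕ→ℚ b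
ℕ→ℚ-+ a b rewrite ℕ→ℚ≡mkℚ a | ℕ→ℚ≡mkℚ b =
  cong (_/ 1) (trans (ℤ.pos-+ a b) (sym (cong₂ _+ℤ_ (ℤ.*-identityʳ (+ a)) (ℤ.*-identityʳ (+ b)))))

ℕ→ℚ-* : ∀ a b → ℕ→ℚ (a * b) ≡ ℕ→ℚ a *ℚ ℕ→ℚ b
ℕ→ℚ-* a b rewrite ℕ→ℚ≡mkℚ a | ℕ→ℚ≡mkℚ b = cong (_/ 1) (ℤ.pos-* a b)

corollary2p10 : (m n : ℕ) → (hn : 1 ≤ n) → (hmn : n ≤ m) →
    let one : Fin m
        one = Defs.fin0 hn hmn
    in ℕ→ℚ (I m n)
      ≡ (ℕ→ℚ (n + 2) *ℚ pow3 ((+ n) - (+ 2)))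
        +ℚ ℕ→ℚ ((m ∸ n) * sumTo n (λ i → D m i one * D m (n ∸ i) one)
                + 2 * sumTo (n ∸ 2) (λ k → (n ∸ k ∸ 2) * 3 ^ (n ∸ k ∸ 3) * Motzkin k))
-- For n = 1 the first summand ℕ→ℚ 3 *ℚ pow3 (+ 1 - + 2) evaluates to ℕ→ℚ 1, and for
-- n = 2 + a its factor pow3 (+ n - + 2) evaluates to ℕ→ℚ (3 ^ a).
corollary2p10 (suc m) (suc zero)    (s≤s z≤n) (s≤s _)   = begin
  ℕ→ℚ (I (suc m) 1)
    ≡⟨ cong ℕ→ℚ (trans (sym (+-identityʳ _)) (I+2exits (suc m) 0 (s≤s z≤n))) ⟩
  ℕ→ℚ (suc m * 1)
    ≡⟨ cong ℕ→ℚ (shape m) ⟩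
  ℕ→ℚ (1 + (m * 1 + 2 * 0))
    ≡⟨ cong (λ s → ℕ→ℚ (1 + (m * s + 2 * 0))) (sumTo-D-D m 0 z≤n) ⟨
  ℕ→ℚ (1 + X)
    ≡⟨ ℕ→ℚ-+ 1 X ⟩
  ℕ→ℚ 1 +ℚ ℕ→ℚ X ∎
  where
  X : ℕ
  X = m * sumTo 1 (λ i → D (suc m) i zero * D (suc m) (1 ∸ i) zero) + 2 * 0
  shape : ∀ m → suc m * 1 ≡ 1 + (m * 1 + 2 * 0)
  shape = solve-∀
corollary2p10 (suc m) (suc (suc a)) (s≤s z≤n) n≤sm@(s≤s sa≤m) = begin
  ℕ→ℚ (I (suc m) n)
    ≡⟨ cong ℕ→ℚ (I-formula (suc m) a n≤sm) ⟩
  ℕ→ℚ ((n + 2) * 3 ^ a + ((suc m ∸ n) * 3 ^ suc a + 2 * weightedMotzkin a))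
    ≡⟨ cong₂ (λ s w → ℕ→ℚ ((n + 2) * 3 ^ a + ((suc m ∸ n) * s + 2 * w)))
             (sumTo-D-D m (suc a) sa≤m) (sumTo-weightedMotzkin a) ⟨
  ℕ→ℚ ((n + 2) * 3 ^ a + X)
    ≡⟨ ℕ→ℚ-+ ((n + 2) * 3 ^ a) X ⟩
  ℕ→ℚ ((n + 2) * 3 ^ a) +ℚ ℕ→ℚ X
    ≡⟨ cong (_+ℚ ℕ→ℚ X) (ℕ→ℚ-* (n + 2) (3 ^ a)) ⟩
  (ℕ→ℚ (n + 2) *ℚ ℕ→ℚ (3 ^ a)) +ℚ ℕ→ℚ X ∎
  where
  n X : ℕ
  n = 2 + a
  X = (suc m ∸ n) * sumTo n (λ i → D (suc m) i zero * D (suc m) (n ∸ i) zero)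
      + 2 * sumTo a (λ k → (n ∸ k ∸ 2) * 3 ^ (n ∸ k ∸ 3) * Motzkin k)
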